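{- Let $\mathcal U$ be a quasi-selective ultrafilter on $\mathbb N$ and let $f:\mathbb N\to\mathbb N$ be primitive recursive. Then $f$ is $\mathcal U$-equivalent to a nondecreasing function, and there exists a set $U=\{u_0<u_1<\cdots<u_n<\cdots\}\in\mathcal U$ with $u_{n+1}>f(u_n)$ for all $n$.
   Context: $\mathbb N=\{0,1,2,\dots\}$. $f\equiv_{\mathcal U}g$ means $\{n: f(n)=g(n)\}\in\mathcal U$. A nonprincipal ultrafilter $\mathcal U$ on $\mathbb N$ is quasi-selective if every $f:\mathbb N\to\mathbb N$ with $f(n)\le n$ for all $n$ is $\mathcal U$-equivalent to a nondecreasing function. -}

module Defs where

open import Data.Nat using (ℕ; zero; suc; _≤_; _<_)
open import Data.Fin using (Fin)
open import Data.Vec using (Vec; []; _∷_; lookup; map)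
open import Data.Product using (Σ; _×_; ∃)
open import Data.Sum using (_⊎_)
open import Data.Empty using (⊥)
open import Relation.Nullary using (¬_)
open import Relation.Binary.PropositionalEquality using (_≡_)

record IsNonprincipalUltrafilter (𝒰 : (ℕ → Set) → Set) : Set₁ where
  field
    upward   : ∀ (A B : ℕ → Set) → (∀ n → A n → B n) → 𝒰 A → 𝒰 B
    inter    : ∀ (A B : ℕ → Set) → 𝒰 A → 𝒰 B → 𝒰 (λ n → A n × B n)
    proper   : ¬ 𝒰 (λ _ → ⊥)
    ultra    : ∀ (A : ℕ → Set) → 𝒰 A ⊎ 𝒰 (λ n → ¬ A n)
    nonprinc : ∀ (k : ℕ) → ¬ 𝒰 (λ n → n ≡ k)

_≡[_]_ : (ℕ → ℕ) → ((ℕ → Set) → Set) → (ℕ → ℕ) → Set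
f ≡[ 𝒰 ] g = 𝒰 (λ n → f n ≡ g n)

Nondecreasing : (ℕ → ℕ) → Set
Nondecreasing g = ∀ m n → m ≤ n → g m ≤ g n

IsQuasiSelective : ((ℕ → Set) → Set) → Set₁
IsQuasiSelective 𝒰 =
  IsNonprincipalUltrafilter 𝒰 ×
  ((f : ℕ → ℕ) → (∀ n → f n ≤ n) →
     Σ (ℕ → ℕ) (λ g → Nondecreasing g × f ≡[ 𝒰 ] g))

data PR : ℕ → Set where
  zer  : PR 0
  succ : PR 1
  proj : ∀ {k} → Fin k → PR k
  comp : ∀ {k m} → PR m → Vec (PR k) m → PR k
  prec : ∀ {k} → PR k → PR (suc (suc k)) → PR (suc k)

mutual
  eval : ∀ {k} → PR k → Vec ℕ k → ℕ
  eval zer xs = 0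
  eval succ (x ∷ []) = suc x
  eval (proj i) xs = lookup xs i
  eval (comp h gs) xs = eval h (evalAll gs xs)
  eval (prec g h) (zero ∷ xs) = eval g xs
  eval (prec g h) (suc n ∷ xs) = eval h (eval (prec g h) (n ∷ xs) ∷ n ∷ xs)

  evalAll : ∀ {k m} → Vec (PR k) m → Vec ℕ k → Vec ℕ m
  evalAll [] xs = []
  evalAll (g ∷ gs) xs = eval g xs ∷ evalAll gs xs

PrimitiveRecursive : (ℕ → ℕ) → Set
PrimitiveRecursive f = Σ (PR 1) (λ c → ∀ n → eval c (n ∷ []) ≡ f n)

-- A primitive recursive f is bounded by some level F of a fast-growing hierarchy, and
-- coarsening the partition of ℕ into singletons finitely often gives a partition p whose
-- intervals outgrow F: F (p (k+1)) < p (k+2). Quasi-selectivity turns a 𝒰-large set meeting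
-- each interval of p at most once into one meeting each interval of the coarsening at most
-- once: the number of p-intervals remaining in m's coarse block is at most m, hence 𝒰-equal
-- to a nondecreasing function, although it strictly decreases along a block. Taking the point
-- of such a thin set in every other interval of p gives u. On the range of u, either f is
-- below the identity, where quasi-selectivity applies to f ⊓ id, or f is monotone, since
-- f (u n) < u (n+1) ≤ u n' < f (u n'); and a function monotone on a decidable set extends
-- to a nondecreasing one.

module Submission where

open import Defs
open import Data.Nat using (ℕ; parity; ⌊_/2⌋; zero; suc; _+_; _∸_; _≤_; _<_; _⊔_; _⊓_; _≤′_; ≤′-refl; ≤′-step; z≤n; s≤s; _≤?_; _<?_; _≟_)
open import Data.Nat.Properties
open import Data.Nat.GeneralisedArithmetic using (fold)
open import Data.Fin using (Fin)
open import Data.Vec using (Vec; []; _∷_; lookup)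
open import Data.Product using (Σ; ∃; _×_; _,_; proj₁; proj₂; map₂)
open import Data.Sum using (inj₁; inj₂)
open import Data.Parity using (Parity; 0ℙ; 1ℙ)
open import Data.Empty using (⊥; ⊥-elim)
open import Data.Unit using (⊤; tt)
open import Relation.Nullary using (¬_; Dec; yes; no; contradiction)
open import Relation.Nullary.Decidable using (map′; _×-dec_; ¬?)
open import Relation.Unary using (Decidable)
open import Function using (id; _∘_)
open import Relation.Binary using (_Preserves_⟶_; tri<; tri≈; tri>)
open import Relation.Binary.PropositionalEquality using (_≡_; refl; sym; trans; cong; subst; subst₂; module ≡-Reasoning)

record IsExpanding (F : ℕ → ℕ) : Set where
  field
    mono : F Preserves _≤_ ⟶ _≤_
    inflationary : ∀ x → x ≤ F x

fold-inflationary : ∀ {F} → (∀ x → x ≤ F x) → ∀ x n → x ≤ fold x F n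
fold-inflationary infl x zero = ≤-refl
fold-inflationary infl x (suc n) = ≤-trans (fold-inflationary infl x n) (infl _)

fold-mono-count : ∀ {F} → (∀ x → x ≤ F x) → ∀ x {m n} → m ≤ n → fold x F m ≤ fold x F n
fold-mono-count {F} infl x m≤n = go (≤⇒≤′ m≤n)
  where
  go : ∀ {m n} → m ≤′ n → fold x F m ≤ fold x F n
  go ≤′-refl = ≤-refl
  go (≤′-step m≤′n) = ≤-trans (go m≤′n) (infl _)

fold-mono-start : ∀ {F} → F Preserves _≤_ ⟶ _≤_ → ∀ n {x y} → x ≤ y → fold x F n ≤ fold y F n
fold-mono-start mono zero x≤y = x≤y
fold-mono-start mono (suc n) x≤y = mono (fold-mono-start mono n x≤y)

fold-mono-step : ∀ {F G} → G Preserves _≤_ ⟶ _≤_ → (∀ y → F y ≤ G y) →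
  ∀ x n → fold x F n ≤ fold x G n
fold-mono-step mono F≤G x zero = ≤-refl
fold-mono-step mono F≤G x (suc n) = ≤-trans (F≤G _) (mono (fold-mono-step mono F≤G x n))

suc∘-expanding : ∀ {F} → IsExpanding F → IsExpanding (suc ∘ F)
suc∘-expanding F-exp = record
  { mono = s≤s ∘ mono
  ; inflationary = λ x → m≤n⇒m≤1+n (inflationary x)
  }
  where open IsExpanding F-exp

-- A block of the coarsened partition starting at X contains more than X intervals of p,
-- each of which lets F be applied once more (outpaces-coarsen).
boost : (ℕ → ℕ) → ℕ → ℕ
boost F x = F (fold x (suc ∘ F) x)

boost-expanding : ∀ {F} → IsExpanding F → IsExpanding (boost F)
boost-expanding {F} F-exp = record
  { mono = λ {x} {y} x≤y →
      mono (≤-trans (fold-mono-count G.inflationary x x≤y) (fold-mono-start G.mono y x≤y))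
  ; inflationary = λ x → ≤-trans (fold-inflationary G.inflationary x x) (inflationary _)
  }
  where
  open IsExpanding F-exp
  module G = IsExpanding (suc∘-expanding F-exp)

-- Shifted by one so that F (F x) ≤ accelerate F x holds also at x = 0.
accelerate : (ℕ → ℕ) → ℕ → ℕ
accelerate F x = boost F (suc x)

accelerate-strict : ∀ {F} → IsExpanding F → ∀ x → x < accelerate F x
accelerate-strict F-exp x = IsExpanding.inflationary (boost-expanding F-exp) (suc x)

accelerate-expanding : ∀ {F} → IsExpanding F → IsExpanding (accelerate F)
accelerate-expanding F-exp = record
  { mono = IsExpanding.mono (boost-expanding F-exp) ∘ s≤s
  ; inflationary = <⇒≤ ∘ accelerate-strict F-exp
  }

fold-≤-accelerate : ∀ {F} → IsExpanding F → ∀ {n x} → n ≤ suc x → fold x F (suc n) ≤ accelerate F x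
fold-≤-accelerate {F} F-exp {n} {x} n≤1+x = mono (begin
  fold x F n             ≤⟨ fold-mono-step G.mono (λ y → n≤1+n (F y)) x n ⟩
  fold x G n             ≤⟨ fold-mono-count G.inflationary x n≤1+x ⟩
  fold x G (suc x)       ≤⟨ fold-mono-start G.mono (suc x) (n≤1+n x) ⟩
  fold (suc x) G (suc x) ∎)
  where
  open IsExpanding F-exp
  open ≤-Reasoning
  G : ℕ → ℕ
  G = suc ∘ F
  module G = IsExpanding (suc∘-expanding F-exp)

fastGrowing : ℕ → ℕ → ℕ
fastGrowing i = fold id accelerate i

fastGrowing-expanding : ∀ i → IsExpanding (fastGrowing i)
fastGrowing-expanding zero = record { mono = λ x≤y → x≤y ; inflationary = λ _ → ≤-refl }
fastGrowing-expanding (suc i) = accelerate-expanding (fastGrowing-expanding i)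

fastGrowing-monoˡ : ∀ {i j} x → i ≤ j → fastGrowing i x ≤ fastGrowing j x
fastGrowing-monoˡ x i≤j = go (≤⇒≤′ i≤j)
  where
  go : ∀ {i j} → i ≤′ j → fastGrowing i x ≤ fastGrowing j x
  go ≤′-refl = ≤-refl
  go (≤′-step {j} i≤′j) =
    ≤-trans (go i≤′j) (fold-≤-accelerate (fastGrowing-expanding j) (z≤n {suc x}))

maximum : ∀ {k} → Vec ℕ k → ℕ
maximum [] = 0
maximum (x ∷ xs) = x ⊔ maximum xs

lookup≤maximum : ∀ {k} (xs : Vec ℕ k) (i : Fin k) → lookup xs i ≤ maximum xs
lookup≤maximum (x ∷ xs) Fin.zero = m≤m⊔n x (maximum xs)
lookup≤maximum (x ∷ xs) (Fin.suc i) = ≤-trans (lookup≤maximum xs i) (m≤n⊔m x (maximum xs))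

BoundedAtLevel : ∀ {k} → (Vec ℕ k → ℕ) → ℕ → Set
BoundedAtLevel e i = ∀ xs → e xs ≤ fastGrowing i (maximum xs)

boundedAtLevel-mono : ∀ {k} {e : Vec ℕ k → ℕ} {i j} → i ≤ j → BoundedAtLevel e i → BoundedAtLevel e j
boundedAtLevel-mono i≤j bounded xs = ≤-trans (bounded xs) (fastGrowing-monoˡ _ i≤j)

prec-bounded : ∀ {k F} {g : PR k} {h : PR (suc (suc k))} → IsExpanding F →
  (∀ xs → eval g xs ≤ F (maximum xs)) → (∀ ys → eval h ys ≤ F (maximum ys)) →
  ∀ xs {N} n → n ≤ N → maximum xs ≤ N → eval (prec g h) (n ∷ xs) ≤ fold N F (suc n)
prec-bounded F-exp g≤ h≤ xs zero _ xs≤N = ≤-trans (g≤ xs) (mono xs≤N)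
  where open IsExpanding F-exp
prec-bounded {F = F} {g} {h} F-exp g≤ h≤ xs {N} (suc n) 1+n≤N xs≤N =
  ≤-trans (h≤ (eval (prec g h) (n ∷ xs) ∷ n ∷ xs))
          (mono (⊔-lub previous≤ (⊔-lub (≤-trans (<⇒≤ 1+n≤N) N≤) (≤-trans xs≤N N≤))))
  where
  open IsExpanding F-exp
  previous≤ : eval (prec g h) (n ∷ xs) ≤ fold N F (suc n)
  previous≤ = prec-bounded F-exp g≤ h≤ xs n (<⇒≤ 1+n≤N) xs≤N
  N≤ : N ≤ fold N F (suc n)
  N≤ = fold-inflationary inflationary N (suc n)

mutual
  PR-bounded : ∀ {k} (c : PR k) → ∃ (BoundedAtLevel (eval c))
  PR-bounded zer = 0 , λ _ → z≤n
  PR-bounded succ = 1 , λ { (x ∷ []) →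
    ≤-trans (s≤s (m≤m⊔n x 0)) (accelerate-strict (fastGrowing-expanding 0) (x ⊔ 0)) }
  PR-bounded (proj i) = 0 , λ xs → lookup≤maximum xs i
  PR-bounded (comp h gs) with PR-bounded h | PRs-bounded gs
  ... | a , h≤ | b , gs≤ = suc c , λ xs → begin
    eval h (evalAll gs xs)                       ≤⟨ boundedAtLevel-mono (m≤m⊔n a b) h≤ (evalAll gs xs) ⟩
    fastGrowing c (maximum (evalAll gs xs))      ≤⟨ mono (boundedAtLevel-mono (m≤n⊔m a b) gs≤ xs) ⟩
    fold (maximum xs) (fastGrowing c) 2          ≤⟨ fold-≤-accelerate (fastGrowing-expanding c) (s≤s z≤n) ⟩
    fastGrowing (suc c) (maximum xs)             ∎
    where
    open ≤-Reasoning
    open IsExpanding (fastGrowing-expanding (a ⊔ b))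
    c : ℕ
    c = a ⊔ b
  PR-bounded (prec g h) with PR-bounded g | PR-bounded h
  ... | a , g≤ | b , h≤ = suc (a ⊔ b) , λ { (n ∷ xs) →
    ≤-trans (prec-bounded (fastGrowing-expanding (a ⊔ b))
               (boundedAtLevel-mono (m≤m⊔n a b) g≤) (boundedAtLevel-mono (m≤n⊔m a b) h≤)
               xs n (m≤m⊔n n _) (m≤n⊔m n _))
            (fold-≤-accelerate (fastGrowing-expanding (a ⊔ b)) (m≤n⇒m≤1+n (m≤m⊔n n _))) }

  PRs-bounded : ∀ {k m} (cs : Vec (PR k) m) → ∃ (BoundedAtLevel (maximum ∘ evalAll cs))
  PRs-bounded [] = 0 , λ _ → z≤n
  PRs-bounded (c ∷ cs) with PR-bounded c | PRs-bounded cs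
  ... | a , c≤ | b , cs≤ = a ⊔ b , λ xs →
    ⊔-lub (boundedAtLevel-mono (m≤m⊔n a b) c≤ xs) (boundedAtLevel-mono (m≤n⊔m a b) cs≤ xs)

StrictlyIncreasing : (ℕ → ℕ) → Set
StrictlyIncreasing u = ∀ n → u n < u (suc n)

module _ {u : ℕ → ℕ} (u-inc : StrictlyIncreasing u) where

  increasing⇒< : ∀ {a b} → a < b → u a < u b
  increasing⇒< a<b = go (≤⇒≤′ a<b)
    where
    go : ∀ {a b} → suc a ≤′ b → u a < u b
    go ≤′-refl = u-inc _
    go (≤′-step a<′b) = <-trans (go a<′b) (u-inc _)

  increasing⇒≤ : ∀ {a b} → a ≤ b → u a ≤ u b
  increasing⇒≤ a≤b with m≤n⇒m<n∨m≡n a≤b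
  ... | inj₁ a<b = <⇒≤ (increasing⇒< a<b)
  ... | inj₂ refl = ≤-refl

  increasing-cancel-< : ∀ {a b} → u a < u b → a < b
  increasing-cancel-< ua<ub = ≰⇒> (λ b≤a → <⇒≱ ua<ub (increasing⇒≤ b≤a))

  increasing-cancel-≤ : ∀ {a b} → u a ≤ u b → a ≤ b
  increasing-cancel-≤ ua≤ub = ≮⇒≥ (λ b<a → <⇒≱ (increasing⇒< b<a) ua≤ub)

  id≤increasing : ∀ n → n ≤ u n
  id≤increasing zero = z≤n
  id≤increasing (suc n) = <-≤-trans (s≤s (id≤increasing n)) (u-inc n)

IsPartition : (ℕ → ℕ) → Set
IsPartition p = p 0 ≡ 0 × StrictlyIncreasing p

InInterval : (ℕ → ℕ) → ℕ → ℕ → Set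
InInterval p t m = p t ≤ m × m < p (suc t)

interval-unique : ∀ {p} → StrictlyIncreasing p → ∀ {t t' m} →
  InInterval p t m → InInterval p t' m → t ≡ t'
interval-unique p-inc (pt≤m , m<pt+1) (pt'≤m , m<pt'+1) = ≤-antisym
  (≤-pred (increasing-cancel-< p-inc (≤-<-trans pt≤m m<pt'+1)))
  (≤-pred (increasing-cancel-< p-inc (≤-<-trans pt'≤m m<pt+1)))

locate : ∀ {p} → IsPartition p → ∀ m → ∃ λ t → InInterval p t m
locate {p} (p0≡0 , p-inc) zero = 0 , ≤-reflexive p0≡0 , subst (_< p 1) p0≡0 (p-inc 0)
locate {p} (p0≡0 , p-inc) (suc m) with locate (p0≡0 , p-inc) m
... | t , pt≤m , m<pt+1 with suc m <? p (suc t)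
...   | yes 1+m<pt+1 = t , m≤n⇒m≤1+n pt≤m , 1+m<pt+1
...   | no 1+m≮pt+1 = suc t , ≮⇒≥ 1+m≮pt+1 , ≤-<-trans m<pt+1 (p-inc (suc t))

module _ {p : ℕ → ℕ} (p-part : IsPartition p) where

  index : ℕ → ℕ
  index m = proj₁ (locate p-part m)

  index-interval : ∀ m → InInterval p (index m) m
  index-interval m = proj₂ (locate p-part m)

  index-unique : ∀ {t m} → InInterval p t m → index m ≡ t
  index-unique = interval-unique (proj₂ p-part) (index-interval _)

-- Block j+1 consists of p (blocks p j) + 1 intervals of p: enough for outpaces-coarsen,
-- and few enough to keep the counter of thin-coarsen below the identity.
blocks : (ℕ → ℕ) → ℕ → ℕ
blocks p zero = 0
blocks p (suc j) = suc (blocks p j + p (blocks p j))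

coarsen : (ℕ → ℕ) → ℕ → ℕ
coarsen p j = p (blocks p j)

blocks-partition : ∀ p → IsPartition (blocks p)
blocks-partition p = refl , λ j → s≤s (m≤m+n _ _)

coarsen-partition : ∀ {p} → IsPartition p → IsPartition (coarsen p)
coarsen-partition {p} (p0≡0 , p-inc) = p0≡0 , λ j → increasing⇒< p-inc (proj₂ (blocks-partition p) j)

block-interval : ∀ {p} → StrictlyIncreasing p → ∀ {k t m} →
  InInterval (coarsen p) k m → InInterval p t m → InInterval (blocks p) k t
block-interval p-inc (qk≤m , m<qk+1) (pt≤m , m<pt+1) =
  ≤-pred (increasing-cancel-< p-inc (≤-<-trans qk≤m m<pt+1)) ,
  increasing-cancel-< p-inc (≤-<-trans pt≤m m<qk+1)

coarsening : ℕ → ℕ → ℕ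
coarsening L = fold id coarsen L

coarsening-partition : ∀ L → IsPartition (coarsening L)
coarsening-partition zero = refl , λ _ → ≤-refl
coarsening-partition (suc L) = coarsen-partition (coarsening-partition L)

Outpaces : (ℕ → ℕ) → (ℕ → ℕ) → Set
Outpaces p F = ∀ k → F (p (suc k)) < p (suc (suc k))

outpaces-coarsen : ∀ {p F} → F Preserves _≤_ ⟶ _≤_ → Outpaces p F → Outpaces (coarsen p) (boost F)
outpaces-coarsen {p} {F} mono outpaces k = begin-strict
  F (fold X G X)           ≤⟨ mono (iterates≤ X) ⟩
  F (p (suc (X + c)))      <⟨ outpaces (X + c) ⟩
  p (suc (suc (X + c)))    ≡⟨ cong (p ∘ suc ∘ suc) (+-comm X c) ⟩
  coarsen p (suc (suc k))  ∎
  where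
  open ≤-Reasoning
  G : ℕ → ℕ
  G = suc ∘ F
  c X : ℕ
  c = blocks p k + p (blocks p k)
  X = coarsen p (suc k)
  iterates≤ : ∀ n → fold X G n ≤ p (suc (n + c))
  iterates≤ zero = ≤-refl
  iterates≤ (suc n) = ≤-trans (s≤s (mono (iterates≤ n))) (outpaces (n + c))

outpaces-weaken : ∀ {p F G} → StrictlyIncreasing p → (∀ x → 1 ≤ x → F x ≤ G x) →
  Outpaces p G → Outpaces p F
outpaces-weaken p-inc F≤G outpaces k = ≤-<-trans (F≤G _ (≤-<-trans z≤n (p-inc k))) (outpaces k)

accelerate≤boost² : ∀ {F} → IsExpanding F → ∀ x → 1 ≤ x → accelerate F x ≤ boost (boost F) x
accelerate≤boost² {F} F-exp x 1≤x = B.mono (begin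
  suc x                        ≤⟨ s≤s (B.inflationary x) ⟩
  fold x (suc ∘ boost F) 1     ≤⟨ fold-mono-count G.inflationary x 1≤x ⟩
  fold x (suc ∘ boost F) x     ∎)
  where
  open ≤-Reasoning
  B-exp : IsExpanding (boost F)
  B-exp = boost-expanding F-exp
  module B = IsExpanding B-exp
  module G = IsExpanding (suc∘-expanding B-exp)

outpaced : ∀ i → ∃ λ L → Outpaces (coarsening L) (fastGrowing i)
outpaced zero = 0 , λ k → ≤-refl
outpaced (suc i) with outpaced i
... | L , outpaces = suc (suc L) ,
  outpaces-weaken (proj₂ (coarsening-partition (suc (suc L)))) (accelerate≤boost² F-exp)
    (outpaces-coarsen {coarsen (coarsening L)} (IsExpanding.mono (boost-expanding F-exp))
      (outpaces-coarsen {coarsening L} (IsExpanding.mono F-exp) outpaces))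
  where
  F-exp : IsExpanding (fastGrowing i)
  F-exp = fastGrowing-expanding i

Range : (ℕ → ℕ) → ℕ → Set
Range u m = Σ ℕ (λ n → u n ≡ m)

range? : ∀ {u} → StrictlyIncreasing u → Decidable (Range u)
range? {u} u-inc m = map′
  (λ { (n , _ , un≡m) → n , un≡m })
  (λ { (n , un≡m) → n , s≤s (≤-trans (id≤increasing u-inc n) (≤-reflexive un≡m)) , un≡m })
  (anyUpTo? (λ n → u n ≟ m) (suc m))

monotone-extension : ∀ {D : ℕ → Set} → Decidable D → (f : ℕ → ℕ) →
  (∀ {m m'} → D m → D m' → m ≤ m' → f m ≤ f m') →
  Σ (ℕ → ℕ) λ g → Nondecreasing g × (∀ {m} → D m → f m ≡ g m)
monotone-extension {D} D? f f-mono = g , g-nondecreasing , agree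
  where
  restricted : ℕ → ℕ
  restricted x with D? x
  ... | yes _ = f x
  ... | no _ = 0

  restricted-on : ∀ {x} → D x → restricted x ≡ f x
  restricted-on {x} x∈D with D? x
  ... | yes _ = refl
  ... | no x∉D = contradiction x∈D x∉D

  restricted≤ : ∀ {x z} → D z → x ≤ z → restricted x ≤ f z
  restricted≤ {x} z∈D x≤z with D? x
  ... | yes x∈D = f-mono x∈D z∈D x≤z
  ... | no _ = z≤n

  g : ℕ → ℕ
  g zero = restricted 0
  g (suc x) = g x ⊔ restricted (suc x)

  g-nondecreasing : Nondecreasing g
  g-nondecreasing m n m≤n = go (≤⇒≤′ m≤n)
    where
    go : ∀ {n} → m ≤′ n → g m ≤ g n
    go ≤′-refl = ≤-refl
    go (≤′-step m≤′n) = ≤-trans (go m≤′n) (m≤m⊔n _ _)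

  restricted≤g : ∀ x → restricted x ≤ g x
  restricted≤g zero = ≤-refl
  restricted≤g (suc x) = m≤n⊔m _ _

  g≤ : ∀ {x z} → D z → x ≤ z → g x ≤ f z
  g≤ {zero} z∈D x≤z = restricted≤ z∈D x≤z
  g≤ {suc x} z∈D x≤z = ⊔-lub (g≤ z∈D (≤-trans (n≤1+n x) x≤z)) (restricted≤ z∈D x≤z)

  agree : ∀ {m} → D m → f m ≡ g m
  agree {m} m∈D = ≤-antisym (subst (_≤ g m) (restricted-on m∈D) (restricted≤g m)) (g≤ m∈D ≤-refl)

ofParity : Parity → ℕ → ℕ
ofParity e = fold (offset e) (suc ∘ suc)
  where
  offset : Parity → ℕ
  offset 0ℙ = 0
  offset 1ℙ = 1

ofParity-parity : ∀ t → ofParity (parity t) ⌊ t /2⌋ ≡ t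
ofParity-parity zero = refl
ofParity-parity (suc zero) = refl
ofParity-parity (suc (suc t)) = cong (suc ∘ suc) (ofParity-parity t)

module _ {𝒰 : (ℕ → Set) → Set} (𝒰-ultra : IsNonprincipalUltrafilter 𝒰) where
  open IsNonprincipalUltrafilter 𝒰-ultra

  full : 𝒰 (λ _ → ⊤)
  full with ultra (λ _ → ⊥)
  ... | inj₁ ∅∈𝒰 = ⊥-elim (proper ∅∈𝒰)
  ... | inj₂ ∅ᶜ∈𝒰 = upward _ _ (λ _ _ → tt) ∅ᶜ∈𝒰

  large-parity-class : ∀ {A} (c : ℕ → Parity) → 𝒰 A → ∃ λ e → 𝒰 (λ m → A m × c m ≡ e)
  large-parity-class {A} c A∈𝒰 with ultra (λ m → A m × c m ≡ 0ℙ)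
  ... | inj₁ even∈𝒰 = 0ℙ , even∈𝒰
  ... | inj₂ notEven∈𝒰 = 1ℙ , upward _ _ odd (inter _ _ notEven∈𝒰 A∈𝒰)
    where
    odd : ∀ m → ¬ (A m × c m ≡ 0ℙ) × A m → A m × c m ≡ 1ℙ
    odd m (notEven , m∈A) with c m
    ... | 0ℙ = contradiction (m∈A , refl) notEven
    ... | 1ℙ = m∈A , refl

  record Thin (p : ℕ → ℕ) : Set₁ where
    field
      member : ℕ → Set
      member? : Decidable member
      large : 𝒰 member
      thin : ∀ {t m m'} → InInterval p t m → InInterval p t m' → member m → member m' → m ≡ m'

  thin-identity : Thin id
  thin-identity = record
    { member = λ _ → ⊤
    ; member? = λ _ → yes tt
    ; large = full
    ; thin = λ { (t≤m , m<1+t) (t≤m' , m'<1+t) _ _ →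
        trans (≤-antisym (≤-pred m<1+t) t≤m) (sym (≤-antisym (≤-pred m'<1+t) t≤m')) }
    }

  HasNondecreasingRep : (ℕ → ℕ) → Set
  HasNondecreasingRep f = Σ (ℕ → ℕ) (λ g → Nondecreasing g × f ≡[ 𝒰 ] g)

  SparseFor : (ℕ → ℕ) → (ℕ → ℕ) → Set
  SparseFor f u = StrictlyIncreasing u × 𝒰 (Range u) × (∀ n → f (u n) < u (suc n))

  sparse-monotone : ∀ {f u} → SparseFor f u → ∀ {m m'} → Range u m → Range u m' →
    m' < f m' → m ≤ m' → f m ≤ f m'
  sparse-monotone {f} {u} (u-inc , _ , u-sparse) (n , refl) (n' , refl) m'<fm' un≤un'
    with m≤n⇒m<n∨m≡n (increasing-cancel-≤ u-inc un≤un')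
  ... | inj₂ refl = ≤-refl
  ... | inj₁ n<n' = <⇒≤ (<-trans (u-sparse n) (≤-<-trans (increasing⇒≤ u-inc n<n') m'<fm'))

  representative-above : ∀ {f u} → SparseFor f u → 𝒰 (λ m → ¬ f m ≤ m) → HasNondecreasingRep f
  representative-above {f} {u} u-sparse@(u-inc , range∈𝒰 , _) above∈𝒰 =
    map₂ (map₂ (λ agrees → upward _ _ (λ m → agrees {m}) (inter _ _ range∈𝒰 above∈𝒰)))
         (monotone-extension D? f f-mono)
    where
    D : ℕ → Set
    D m = Range u m × ¬ f m ≤ m
    D? : Decidable D
    D? m = range? u-inc m ×-dec ¬? (f m ≤? m)
    f-mono : ∀ {m m'} → D m → D m' → m ≤ m' → f m ≤ f m'
    f-mono (m∈ , _) (m'∈ , fm'≰m') = sparse-monotone u-sparse m∈ m'∈ (≰⇒> fm'≰m')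

  module _ {p F f : ℕ → ℕ} (p-part : IsPartition p) (T : Thin p) (F-mono : F Preserves _≤_ ⟶ _≤_)
           (outpaces : Outpaces p F) (f≤F : ∀ x → f x ≤ F x) where
    open Thin T

    private
      p-inc : StrictlyIncreasing p
      p-inc = proj₂ p-part

    search : ∀ k → Dec (∃ λ m → m < p (suc k) × p k ≤ m × member m)
    search k = anyUpTo? (λ m → p k ≤? m ×-dec member? m) (p (suc k))

    pick : ℕ → ℕ
    pick k with search k
    ... | yes (m , _) = m
    ... | no _ = p k

    pick-interval : ∀ k → InInterval p k (pick k)
    pick-interval k with search k
    ... | yes (m , m<pk+1 , pk≤m , _) = pk≤m , m<pk+1
    ... | no _ = ≤-refl , p-inc k

    pick-member : ∀ {k m} → InInterval p k m → member m → pick k ≡ m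
    pick-member {k} {m} (pk≤m , m<pk+1) m∈ with search k
    ... | yes (m₀ , m₀<pk+1 , pk≤m₀ , m₀∈) = thin (pk≤m₀ , m₀<pk+1) (pk≤m , m<pk+1) m₀∈ m∈
    ... | no none = contradiction (m , m<pk+1 , pk≤m , m∈) none


    -- Using every other interval leaves a whole interval of p, where Outpaces puts F,
    -- between consecutive picks.
    sparse-of-parity : ∀ e → 𝒰 (λ m → member m × parity (index p-part m) ≡ e) → ∃ (SparseFor f)
    sparse-of-parity e large-class = u , u-inc , upward _ _ in-range large-class , u-sparse
      where
      u : ℕ → ℕ
      u n = pick (ofParity e n)
      u-inc : StrictlyIncreasing u
      u-inc n = <-≤-trans (proj₂ (pick-interval k))
                  (≤-trans (<⇒≤ (p-inc (suc k))) (proj₁ (pick-interval (suc (suc k)))))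
        where
        k : ℕ
        k = ofParity e n
      u-sparse : ∀ n → f (u n) < u (suc n)
      u-sparse n = ≤-<-trans (f≤F _) (≤-<-trans (F-mono (<⇒≤ (proj₂ (pick-interval k))))
                     (<-≤-trans (outpaces k) (proj₁ (pick-interval (suc (suc k))))))
        where
        k : ℕ
        k = ofParity e n
      in-range : ∀ m → member m × parity (index p-part m) ≡ e → Range u m
      in-range m (m∈ , parity≡e) = ⌊ t /2⌋ , (begin
        pick (ofParity e ⌊ t /2⌋)          ≡⟨ cong (λ e → pick (ofParity e ⌊ t /2⌋)) (sym parity≡e) ⟩
        pick (ofParity (parity t) ⌊ t /2⌋) ≡⟨ cong pick (ofParity-parity t) ⟩
        pick t                             ≡⟨ pick-member (index-interval p-part m) m∈ ⟩
        m                                  ∎)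
        where
        open ≡-Reasoning
        t : ℕ
        t = index p-part m

    thin⇒sparse : ∃ (SparseFor f)
    thin⇒sparse with large-parity-class (parity ∘ index p-part) large
    ... | e , large-class = sparse-of-parity e large-class

  module _ (selective : (f : ℕ → ℕ) → (∀ n → f n ≤ n) → HasNondecreasingRep f) where

    thin-coarsen : ∀ {p} → IsPartition p → Thin p → Thin (coarsen p)
    thin-coarsen {p} p-part T = record
      { member = member′
      ; member? = λ m → member? m ×-dec (remaining m ≟ g m)
      ; large = inter _ _ large g-agrees
      ; thin = thin′
      }
      where
      open Thin T

      p-inc : StrictlyIncreasing p
      p-inc = proj₂ p-part

      q-part : IsPartition (coarsen p)
      q-part = coarsen-partition p-part

      b : ℕ → ℕ
      b = blocks p

      remaining : ℕ → ℕ
      remaining m = b (suc (index q-part m)) ∸ suc (index p-part m)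

      remaining-in : ∀ {k m} → InInterval (coarsen p) k m →
        remaining m ≡ b (suc k) ∸ suc (index p-part m)
      remaining-in {m = m} m∈k = cong (λ j → b (suc j) ∸ suc (index p-part m)) (index-unique q-part m∈k)

      remaining≤id : ∀ m → remaining m ≤ m
      remaining≤id m = begin
        b (suc k) ∸ suc t     ≤⟨ ∸-monoʳ-≤ (b k + p (b k)) (proj₁ t∈k) ⟩
        b (suc k) ∸ suc (b k) ≡⟨ m+n∸m≡n (b k) (p (b k)) ⟩
        p (b k)               ≤⟨ proj₁ m∈k ⟩
        m                     ∎
        where
        open ≤-Reasoning
        k t : ℕ
        k = index q-part m
        t = index p-part m
        m∈k : InInterval (coarsen p) k m
        m∈k = index-interval q-part m
        t∈k : InInterval b k t
        t∈k = block-interval p-inc m∈k (index-interval p-part m)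

      selected : HasNondecreasingRep remaining
      selected = selective remaining remaining≤id

      g : ℕ → ℕ
      g = proj₁ selected

      g-nondecreasing : Nondecreasing g
      g-nondecreasing = proj₁ (proj₂ selected)

      g-agrees : remaining ≡[ 𝒰 ] g
      g-agrees = proj₂ (proj₂ selected)

      member′ : ℕ → Set
      member′ m = member m × remaining m ≡ g m

      separated : ∀ {k m m'} → InInterval (coarsen p) k m → InInterval (coarsen p) k m' →
        remaining m ≡ g m → remaining m' ≡ g m' → ¬ index p-part m < index p-part m'
      separated {k} {m} {m'} m∈k m'∈k em em' t<t' = <-irrefl refl (begin-strict
        remaining m'        ≡⟨ remaining-in m'∈k ⟩
        b (suc k) ∸ suc t'  <⟨ ∸-monoʳ-< (s≤s t<t') (proj₂ t'∈k) ⟩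
        b (suc k) ∸ suc t   ≡⟨ sym (remaining-in m∈k) ⟩
        remaining m         ≡⟨ em ⟩
        g m                 ≤⟨ g-nondecreasing m m' m≤m' ⟩
        g m'                ≡⟨ sym em' ⟩
        remaining m'        ∎)
        where
        open ≤-Reasoning
        t t' : ℕ
        t = index p-part m
        t' = index p-part m'
        t'∈k : InInterval b k t'
        t'∈k = block-interval p-inc m'∈k (index-interval p-part m')
        m≤m' : m ≤ m'
        m≤m' = <⇒≤ (<-≤-trans (proj₂ (index-interval p-part m))
                     (≤-trans (increasing⇒≤ p-inc t<t') (proj₁ (index-interval p-part m'))))

      thin′ : ∀ {k m m'} → InInterval (coarsen p) k m → InInterval (coarsen p) k m' →
        member′ m → member′ m' → m ≡ m'
      thin′ {k} {m} {m'} m∈k m'∈k (m∈ , em) (m'∈ , em') with <-cmp (index p-part m) (index p-part m')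
      ... | tri< t<t' _ _ = contradiction t<t' (separated m∈k m'∈k em em')
      ... | tri> _ _ t'<t = contradiction t'<t (separated m'∈k m∈k em' em)
      ... | tri≈ _ t≡t' _ = thin (index-interval p-part m)
                              (subst (λ t → InInterval p t m') (sym t≡t') (index-interval p-part m')) m∈ m'∈

    thin-coarsening : ∀ L → Thin (coarsening L)
    thin-coarsening zero = thin-identity
    thin-coarsening (suc L) = thin-coarsen (coarsening-partition L) (thin-coarsening L)

    sparse-sequence : ∀ {f} → PrimitiveRecursive f → ∃ (SparseFor f)
    sparse-sequence {f} (c , c≡f) with PR-bounded c
    ... | i , c≤ with outpaced i
    ...   | L , outpaces = thin⇒sparse (coarsening-partition L) (thin-coarsening L)
                             (IsExpanding.mono (fastGrowing-expanding i)) outpaces f≤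
      where
      f≤ : ∀ x → f x ≤ fastGrowing i x
      f≤ x = subst₂ _≤_ (c≡f x) (cong (fastGrowing i) (⊔-identityʳ x)) (c≤ (x ∷ []))

    representative-below : ∀ {f} → 𝒰 (λ m → f m ≤ m) → HasNondecreasingRep f
    representative-below {f} below∈𝒰 =
      map₂ (map₂ (λ agrees → upward _ _ (λ m (fm≤m , e) → trans (sym (m≤n⇒m⊓n≡m fm≤m)) e)
                                    (inter _ _ below∈𝒰 agrees)))
           (selective (λ m → f m ⊓ m) (λ m → m⊓n≤n (f m) m))

    nondecreasing-representative : ∀ {f u} → SparseFor f u → HasNondecreasingRep f
    nondecreasing-representative {f} u-sparse with ultra (λ m → f m ≤ m)
    ... | inj₁ below∈𝒰 = representative-below below∈𝒰
    ... | inj₂ above∈𝒰 = representative-above u-sparse above∈𝒰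

corollary1p8 : (𝒰 : (ℕ → Set) → Set) → IsQuasiSelective 𝒰 →
    (f : ℕ → ℕ) → PrimitiveRecursive f →
    Σ (ℕ → ℕ) (λ g → Nondecreasing g × f ≡[ 𝒰 ] g) ×
    Σ (ℕ → ℕ) (λ u → (∀ n → u n < u (suc n)) ×
      𝒰 (λ m → Σ ℕ (λ n → u n ≡ m)) ×
      (∀ n → f (u n) < u (suc n)))
corollary1p8 𝒰 (𝒰-ultra , selective) f f-pr with sparse-sequence 𝒰-ultra selective f-pr
... | u , u-sparse = nondecreasing-representative 𝒰-ultra selective u-sparse , u , u-sparse
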